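{- Let $D$ be a minimal strong digraph and let $C_q$ be a directed cycle of length $q\ge 2$ contained in $D$. Then the number of linear vertices of $D$ is at least $\left\lfloor \frac{q+1}{2}\right\rfloor$.
   Context: An arc $uv$ of a digraph is transitive if there is another directed $uv$-path not using the arc $uv$. A minimal strong digraph is a strongly connected digraph with no transitive arcs. A vertex $v$ of $D$ is linear if its indegree and outdegree in $D$ are both equal to $1$. -}

module Defs where

open import Data.Nat using (ℕ; zero; suc; _+_; _≥_; _/_)
open import Data.Fin using (Fin; zero; suc; inject₁; fromℕ)
open import Data.Bool using (Bool; true; false; _∧_)
open import Data.List using (List; length; filter)
open import Data.Fin.Base using (toℕ)
open import Data.List using (allFin)
open import Data.Product using (Σ; _×_; ∃; _,_)
open import Relation.Binary.PropositionalEquality using (_≡_; _≢_)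
open import Relation.Nullary using (¬_)
open import Function.Definitions using (Injective)
open import Data.Nat using (_≟_)
open import Relation.Nullary.Decidable using (⌊_⌋)
open import Data.Fin using (lower₁)
open import Data.Nat.Properties using (suc-injective)
open import Relation.Binary.PropositionalEquality using (sym)
open import Relation.Unary using (Decidable)
open import Relation.Nullary using (yes; no)
open import Relation.Nullary.Decidable using (_×-dec_)
open import Data.Bool using (T?)

record Digraph (n : ℕ) : Set where
  field
    arc      : Fin n → Fin n → Bool
    loopless : ∀ v → arc v v ≡ false

open Digraph public

Arc : ∀ {n} → Digraph n → Fin n → Fin n → Set
Arc D u v = arc D u v ≡ true

record Path {n : ℕ} (D : Digraph n) (k : ℕ) (u v : Fin n) : Set where
  field
    vert     : Fin (suc k) → Fin n
    distinct : Injective _≡_ _≡_ vert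
    start    : vert zero ≡ u
    end      : vert (fromℕ k) ≡ v
    step     : ∀ (i : Fin k) → Arc D (vert (inject₁ i)) (vert (suc i))

StronglyConnected : ∀ {n} → Digraph n → Set
StronglyConnected {n} D = ∀ (u v : Fin n) → Σ ℕ λ k → Path D k u v

-- An arc uv is transitive if there is another directed uv-path not using
-- the arc uv; since paths have distinct vertices, a uv-path uses the arc uv
-- exactly when it is the one-arc path, so this means a uv-path of length ≥ 2.
TransitiveArc : ∀ {n} → Digraph n → Fin n → Fin n → Set
TransitiveArc D u v = Arc D u v × (Σ ℕ λ k → (k ≥ 2) × Path D k u v)

MinimalStrong : ∀ {n} → Digraph n → Set
MinimalStrong {n} D =
  StronglyConnected D × (∀ (u v : Fin n) → ¬ TransitiveArc D u v)

sucMod : ∀ {q} → Fin q → Fin q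
sucMod {suc q} i with toℕ i ≟ q
... | yes _ = zero
... | no ¬p = lower₁ (suc i) (λ eq → ¬p (sym (suc-injective eq)))

record Cycle {n : ℕ} (D : Digraph n) (q : ℕ) : Set where
  field
    vert     : Fin q → Fin n
    distinct : Injective _≡_ _≡_ vert
    step     : ∀ (i : Fin q) → Arc D (vert i) (vert (sucMod i))

outdeg : ∀ {n} → Digraph n → Fin n → ℕ
outdeg {n} D v = length (filter (λ w → T? (arc D v w)) (allFin n))

indeg : ∀ {n} → Digraph n → Fin n → ℕ
indeg {n} D v = length (filter (λ w → T? (arc D w v)) (allFin n))

Linear : ∀ {n} → Digraph n → Fin n → Set
Linear D v = (indeg D v ≡ 1) × (outdeg D v ≡ 1)

linear? : ∀ {n} (D : Digraph n) → Decidable (Linear D)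
linear? D v = (indeg D v ≟ 1) ×-dec (outdeg D v ≟ 1)

numLinear : ∀ {n} → Digraph n → ℕ
numLinear {n} D = length (filter (linear? D) (allFin n))

module Submission where

-- The vertex set X of the cycle is strongly connected.  If t ∈ X has an arc t → w leaving X,
-- a walk from w back to X (an ear) enlarges X to a strongly connected set X⁺.  Either some ear
-- vertex has an arc leaving X⁺, and t is traded for that exit of X⁺, or none has, and then
-- minimality (no arc has a bypass) forces w to be linear.  By induction on the number of
-- vertices outside X, distinct exits of X plus distinct linear vertices in X number at most
-- numLinear D.  A cycle vertex with no arc to or from outside the cycle is linear, since a
-- chord would be transitive.  Applying the bound to D and to its converse counts every cycle
-- vertex at least once, so q ≤ 2 · numLinear D.

open import Defs
open import Data.Nat using (ℕ; zero; suc; _+_; _*_; _≥_; _/_; _≤_; _<_; z≤n; s≤s; s≤s⁻¹)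
open import Data.Nat using () renaming (_≟_ to _≟ⁿ_)
open import Data.Nat.Properties
  using ( ≤-antisym; ≤-trans; ≤-reflexive; *-suc; *-identityʳ; +-suc; +-comm; +-monoˡ-≤; +-monoʳ-≤
        ; +-mono-≤; n≤1+n; m≤m+n; n<1+n; module ≤-Reasoning)
open import Data.Nat.Induction using (<-wellFounded)
open import Data.Nat.DivMod using (m<n*o⇒m/o<n)
open import Data.Fin using (Fin; zero; suc; fromℕ; inject₁; toℕ)
open import Data.Fin.Properties
  using (any?; toℕ-fromℕ; toℕ-inject₁-≢; lower₁-inject₁′; suc-injective) renaming (_≟_ to _≟ᶠ_)
open import Data.Fin.Induction using (<-weakInduction; >-weakInduction)
open import Data.Fin.Relation.Unary.Top using (view; ‵fromℕ; ‵inject₁)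
open import Data.Bool using (true)
open import Data.Bool.Properties using (T-≡) renaming (_≟_ to _≟ᵇ_)
open import Data.List using (List; []; _∷_; length; filter; allFin; map)
open import Data.List.Properties
  using (filter-notAll; filter-some; filter-reject; filter-≐; length-map; length-tabulate)
open import Data.List.Relation.Unary.All as All using (All; []; _∷_)
open import Data.List.Relation.Unary.All.Properties using (¬Any⇒All¬; all-filter) renaming (map⁺ to All-map⁺)
open import Data.List.Relation.Unary.Any as Any using (Any; here; there)
open import Data.List.Relation.Unary.Unique.Propositional using (Unique; []; _∷_)
open import Data.List.Relation.Unary.Unique.Propositional.Properties
  using (allFin⁺; Unique[x∷xs]⇒x∉xs) renaming (filter⁺ to Unique-filter⁺; map⁺ to Unique-map⁺)
open import Data.List.Membership.Propositional using (_∈_; _∉_; find; lose)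
open import Data.List.Membership.Propositional.Properties using (∈-filter⁺; ∈-filter⁻; ∈-allFin)
import Data.List.Membership.DecPropositional as DecMembership
open import Data.List.Relation.Binary.Subset.Propositional using (_⊆_)
open import Data.List.Relation.Binary.Subset.Propositional.Properties using (∷⁺ʳ)
open import Data.Product using (Σ; ∃; ∃₂; _×_; _,_; proj₁; proj₂; swap)
open import Data.Sum using (_⊎_; inj₁; inj₂)
open import Data.Empty using (⊥; ⊥-elim)
open import Function using (_∘_; id)
open import Function.Bundles using (Equivalence)
open import Function.Definitions using (Injective)
open import Level using (0ℓ)
open import Relation.Nullary using (¬_; Dec; yes; no; ¬?; contradiction)
open import Relation.Nullary.Decidable using (_×-dec_)
open import Relation.Unary using (Decidable; ∁; _∪_; _∩_; _≐_)
open import Relation.Unary.Properties using (∁?; _∪?_; _∩?_)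
open import Relation.Binary using (Rel; DecidableEquality)
open import Relation.Binary.PropositionalEquality using (_≡_; _≢_; refl; sym; trans; cong; subst; subst₂)
open import Relation.Binary.Construct.Closure.ReflexiveTransitive as Star using (Star; ε; _◅_; _◅◅_)
open import Induction.WellFounded using (Acc; acc)

module _ {A : Set} (_≟_ : DecidableEquality A) where

  unique⇒length≤ : ∀ {xs ys : List A} → Unique xs → xs ⊆ ys → length xs ≤ length ys
  unique⇒length≤ [] _ = z≤n
  unique⇒length≤ {x ∷ xs} {ys} (x∉xs ∷ unique) x∷xs⊆ys = begin
    suc (length xs)  ≤⟨ s≤s (unique⇒length≤ unique xs⊆others) ⟩
    suc (length others)
      ≤⟨ filter-notAll (¬? ∘ (x ≟_)) ys (lose (x∷xs⊆ys (here refl)) λ x≢x → x≢x refl) ⟩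
    length ys        ∎
    where
      open ≤-Reasoning
      others : List A
      others = filter (¬? ∘ (x ≟_)) ys
      xs⊆others : xs ⊆ others
      xs⊆others y∈xs = ∈-filter⁺ (¬? ∘ (x ≟_)) (x∷xs⊆ys (there y∈xs)) (All.lookup x∉xs y∈xs)

module _ {A : Set} {P Q : A → Set} (P? : Decidable P) (Q? : Decidable Q) where

  length≤filter+filter+neither : ∀ xs →
    length xs ≤ length (filter P? xs) + (length (filter Q? xs) + length (filter (∁? P? ∩? ∁? Q?) xs))
  length≤filter+filter+neither [] = z≤n
  length≤filter+filter+neither (x ∷ xs) with P? x | Q? x
  ... | yes _ | yes _ = ≤-trans (s≤s (length≤filter+filter+neither xs)) (+-monoʳ-≤ (suc _) (n≤1+n _))
  ... | yes _ | no _  = s≤s (length≤filter+filter+neither xs)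
  ... | no _  | yes _ = ≤-trans (s≤s (length≤filter+filter+neither xs)) (≤-reflexive (sym (+-suc _ _)))
  ... | no _  | no _  =
    let a = length (filter P? xs); b = length (filter Q? xs); c = length (filter (∁? P? ∩? ∁? Q?) xs)
    in ≤-trans (s≤s (length≤filter+filter+neither xs))
               (≤-reflexive (sym (trans (cong (a +_) (+-suc b c)) (+-suc a (b + c)))))

module _ {n : ℕ} where

  count : {P : Fin n → Set} → Decidable P → ℕ
  count P? = length (filter P? (allFin n))

  unique⇒length≤count : {P : Fin n → Set} (P? : Decidable P) →
                        ∀ {xs} → Unique xs → All P xs → length xs ≤ count P?
  unique⇒length≤count P? unique Ps =
    unique⇒length≤ _≟ᶠ_ unique λ v∈xs → ∈-filter⁺ P? (∈-allFin _) (All.lookup Ps v∈xs)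

  count≡1 : {P : Fin n → Set} (P? : Decidable P) → ∀ {a} → P a → (∀ {v} → P v → v ≡ a) → count P? ≡ 1
  count≡1 P? {a} Pa only-a = ≤-antisym
    (unique⇒length≤ _≟ᶠ_ {ys = a ∷ []} (Unique-filter⁺ P? (allFin⁺ n))
      λ v∈ → here (only-a (proj₂ (∈-filter⁻ P? {xs = allFin n} v∈))))
    (filter-some P? (lose (∈-allFin _) Pa))

  count-≐ : {P Q : Fin n → Set} (P? : Decidable P) (Q? : Decidable Q) → P ≐ Q → count P? ≡ count Q?
  count-≐ P? Q? P≐Q = cong length (filter-≐ P? Q? P≐Q (allFin n))

  count-< : {P Q : Fin n → Set} (P? : Decidable P) (Q? : Decidable Q) → (∀ {v} → P v → Q v) →
            ∀ {w} → Q w → ¬ P w → count P? < count Q?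
  count-< {P} {Q} P? Q? P⊆Q {w} Qw ¬Pw = begin-strict
    count P?                                  ≡⟨ cong length (filter-filter (allFin n)) ⟨
    length (filter P? (filter Q? (allFin n)))
      <⟨ filter-notAll P? _ (lose (∈-filter⁺ Q? (∈-allFin w) Qw) ¬Pw) ⟩
    count Q?                                  ∎
    where
      open ≤-Reasoning
      filter-filter : ∀ xs → filter P? (filter Q? xs) ≡ filter P? xs
      filter-filter [] = refl
      filter-filter (x ∷ xs) with Q? x
      ... | no ¬Qx = trans (filter-filter xs) (sym (filter-reject P? (¬Qx ∘ P⊆Q)))
      ... | yes _ with P? x
      ...   | yes _ = cong (x ∷_) (filter-filter xs)
      ...   | no _ = filter-filter xs

module _ {V : Set} {R : Rel V 0ℓ} where

  support : ∀ {a b} → Star R a b → List V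
  support ε = []
  support (_◅_ {i = a} _ s) = a ∷ support s

  takeTo : ∀ {a b y} (s : Star R a b) → y ∈ support s → Σ (Star R a y) λ p → support p ⊆ support s
  takeTo (r ◅ s) (here refl) = ε , λ ()
  takeTo (r ◅ s) (there y∈s) = let p , p⊆s = takeTo s y∈s in r ◅ p , ∷⁺ʳ _ p⊆s

  dropTo : ∀ {a b y} (s : Star R a b) → y ∈ support s → Σ (Star R y b) λ p → support p ⊆ support s
  dropTo s@(_ ◅ _) (here refl) = s , id
  dropTo (r ◅ s) (there y∈s) = let p , p⊆s = dropTo s y∈s in p , there ∘ p⊆s

  Within : (V → Set) → Rel V 0ℓ
  Within P a b = R a b × P a × P b

  widen : ∀ {P Q : V → Set} → (∀ {v} → P v → Q v) → ∀ {a b} → Star (Within P) a b → Star (Within Q) a b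
  widen P⊆Q = Star.map λ (r , Pa , Pb) → r , P⊆Q Pa , P⊆Q Pb

  within : ∀ {P : V → Set} {a b} (s : Star R a b) → (∀ {v} → v ∈ support s → P v) → P b →
           Star (Within P) a b
  within ε _ _ = ε
  within (r ◅ ε) P-support Pb = (r , P-support (here refl) , Pb) ◅ ε
  within (r ◅ s@(_ ◅ _)) P-support Pb =
    (r , P-support (here refl) , P-support (there (here refl))) ◅ within s (P-support ∘ there) Pb

  firstHit : ∀ {P : V → Set} → Decidable P → ∀ {a b} → Star R a b → P b →
             ∃ λ x → P x × Σ (Star R a x) λ s → All (∁ P) (support s)
  firstHit P? ε Pb = _ , Pb , ε , []
  firstHit P? (_◅_ {i = a} r s) Pb with P? a
  ... | yes Pa = a , Pa , ε , []
  ... | no ¬Pa = let x , Px , s′ , outside = firstHit P? s Pb in x , Px , r ◅ s′ , ¬Pa ∷ outside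

  lastExit : ∀ {P : V → Set} → Decidable P → ∀ {a b} → Star R a b → ¬ P b →
             (¬ P a × Star (Within (∁ P)) a b) ⊎
             (∃₂ λ x y → P x × R x y × ¬ P y × Star (Within (∁ P)) y b)
  lastExit P? ε ¬Pb = inj₁ (¬Pb , ε)
  lastExit P? (_◅_ {i = a} r s) ¬Pb with lastExit P? s ¬Pb
  ... | inj₂ exit = inj₂ exit
  ... | inj₁ (¬Pa′ , s′) with P? a
  ...   | yes Pa = inj₂ (_ , _ , Pa , r , ¬Pa′ , s′)
  ...   | no ¬Pa = inj₁ (¬Pa , (r , ¬Pa , ¬Pa′) ◅ s′)

  Simple : ∀ {a b} → Star R a b → Set
  Simple {b = b} s = Unique (support s) × b ∉ support s

  dropTo-simple : ∀ {a b y} (s : Star R a b) (y∈s : y ∈ support s) → Simple s →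
                  Simple (proj₁ (dropTo s y∈s))
  dropTo-simple (_ ◅ _) (here refl) simple = simple
  dropTo-simple (r ◅ s) (there y∈s) (_ ∷ unique , b∉) = dropTo-simple s y∈s (unique , b∉ ∘ there)

  module _ (_≟_ : DecidableEquality V) where
    open DecMembership _≟_ using (_∈?_)

    erase : ∀ {a b} (s : Star R a b) → Σ (Star R a b) λ s′ → Simple s′ × support s′ ⊆ support s
    erase ε = ε , ([] , λ ()) , id
    erase {b = b} (_◅_ {i = a} r s) with erase s
    ... | s′ , simple′ , s′⊆s with a ∈? support s′
    ...   | yes a∈s′ = let s″ , s″⊆s′ = dropTo s′ a∈s′ in
                       s″ , dropTo-simple s′ a∈s′ simple′ , there ∘ s′⊆s ∘ s″⊆s′
    ...   | no a∉s′ with a ≟ b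
    ...     | yes refl = ε , ([] , λ ()) , λ ()
    ...     | no a≢b = r ◅ s′ , (¬Any⇒All¬ _ a∉s′ ∷ proj₁ simple′ , b∉) , ∷⁺ʳ a s′⊆s
      where
        b∉ : b ∉ a ∷ support s′
        b∉ (here b≡a) = a≢b (sym b≡a)
        b∉ (there b∈s′) = proj₂ simple′ b∈s′

  vertexAt : ∀ {a b} (s : Star R a b) → Fin (suc (length (support s))) → V
  vertexAt {a} ε _ = a
  vertexAt {a} (_ ◅ _) zero = a
  vertexAt (_ ◅ s) (suc i) = vertexAt s i

  vertexAt-zero : ∀ {a b} (s : Star R a b) → vertexAt s zero ≡ a
  vertexAt-zero ε = refl
  vertexAt-zero (_ ◅ _) = refl

  vertexAt-last : ∀ {a b} (s : Star R a b) → vertexAt s (fromℕ _) ≡ b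
  vertexAt-last ε = refl
  vertexAt-last (_ ◅ s) = vertexAt-last s

  vertexAt-step : ∀ {a b} (s : Star R a b) (i : Fin (length (support s))) →
                  R (vertexAt s (inject₁ i)) (vertexAt s (suc i))
  vertexAt-step (r ◅ s) zero = subst (R _) (sym (vertexAt-zero s)) r
  vertexAt-step (_ ◅ s) (suc i) = vertexAt-step s i

  vertexAt-∈ : ∀ {a b} (s : Star R a b) i → vertexAt s i ∈ support s ⊎ vertexAt s i ≡ b
  vertexAt-∈ ε _ = inj₂ refl
  vertexAt-∈ (_ ◅ _) zero = inj₁ (here refl)
  vertexAt-∈ (_ ◅ s) (suc i) with vertexAt-∈ s i
  ... | inj₁ ∈s = inj₁ (there ∈s)
  ... | inj₂ ≡b = inj₂ ≡b

  head-fresh : ∀ {a a′ b} {r : R a a′} (s : Star R a′ b) → Simple (r ◅ s) → ∀ i → a ≢ vertexAt s i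
  head-fresh s (a∉s ∷ _ , b∉) i a≡ with vertexAt-∈ s i
  ... | inj₁ ∈s = All.lookup a∉s ∈s a≡
  ... | inj₂ ≡b = b∉ (here (sym (trans a≡ ≡b)))

  vertexAt-injective : ∀ {a b} (s : Star R a b) → Simple s → Injective _≡_ _≡_ (vertexAt s)
  vertexAt-injective ε _ {zero} {zero} _ = refl
  vertexAt-injective (_ ◅ _) _ {zero} {zero} _ = refl
  vertexAt-injective (r ◅ s) simple {zero} {suc j} a≡ = ⊥-elim (head-fresh {r = r} s simple j a≡)
  vertexAt-injective (r ◅ s) simple {suc i} {zero} ≡a = ⊥-elim (head-fresh {r = r} s simple i (sym ≡a))
  vertexAt-injective (_ ◅ s) (_ ∷ unique , b∉) {suc i} {suc j} eq =
    cong suc (vertexAt-injective s (unique , b∉ ∘ there) eq)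

module _ {n : ℕ} (D : Digraph n) where

  ArcIn : (Fin n → Set) → Rel (Fin n) 0ℓ
  ArcIn X = Within {R = Arc D} X

  ArcExcept : Fin n → Fin n → Rel (Fin n) 0ℓ
  ArcExcept u v a b = Arc D a b × ¬ (a ≡ u × b ≡ v)

  -- MinimalStrong phrased with walks, which unlike paths can be concatenated and reversed.
  record WalkMinimalStrong : Set where
    field
      reach    : ∀ u v → Star (Arc D) u v
      noBypass : ∀ {u v} → Arc D u v → ¬ Star (ArcExcept u v) u v

  StronglyConnectedIn : (Fin n → Set) → Set
  StronglyConnectedIn X = ∀ {a b} → X a → X b → Star (ArcIn X) a b

  Exit : (Fin n → Set) → Fin n → Set
  Exit X v = ∃ λ u → Arc D v u × ¬ X u

  exit? : ∀ {X} → Decidable X → Decidable (Exit X)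
  exit? X? v = any? λ u → (arc D v u ≟ᵇ true) ×-dec ∁? X? u

converse : ∀ {n} → Digraph n → Digraph n
converse D = record { arc = λ u v → arc D v u ; loopless = loopless D }

module WalkLemmas {n : ℕ} (D : Digraph n) where

  avoidSource : ∀ {X u v a b} → ¬ X u → Star (ArcIn D X) a b → Star (ArcExcept D u v) a b
  avoidSource {X} ¬Xu = Star.map λ (r , Xa , _) → r , λ (a≡u , _) → ¬Xu (subst X a≡u Xa)

  avoidTarget : ∀ {X u v a b} → ¬ X v → Star (ArcIn D X) a b → Star (ArcExcept D u v) a b
  avoidTarget {X} ¬Xv = Star.map λ (r , _ , Xb) → r , λ (_ , b≡v) → ¬Xv (subst X b≡v Xb)

  path⇒walk : ∀ {k u v} → Path D k u v → Star (Arc D) u v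
  path⇒walk {k} P = subst₂ (Star (Arc D)) start end (walkOf k vert step)
    where
      open Path P
      walkOf : ∀ k (f : Fin (suc k) → Fin n) → (∀ i → Arc D (f (inject₁ i)) (f (suc i))) →
               Star (Arc D) (f zero) (f (fromℕ k))
      walkOf zero f steps = ε
      walkOf (suc k) f steps = steps zero ◅ walkOf k (f ∘ suc) (steps ∘ suc)

  simple⇒path : ∀ {R : Rel (Fin n) 0ℓ} → (∀ {a b} → R a b → Arc D a b) →
                ∀ {u v} (s : Star R u v) → Simple s → Path D (length (support s)) u v
  simple⇒path R⇒Arc s simple = record
    { vert     = vertexAt s
    ; distinct = vertexAt-injective s simple
    ; start    = vertexAt-zero s
    ; end      = vertexAt-last s
    ; step     = R⇒Arc ∘ vertexAt-step s
    }

  minimalStrong⇒walkMinimalStrong : MinimalStrong D → WalkMinimalStrong D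
  minimalStrong⇒walkMinimalStrong (strong , noTransitive) = record
    { reach    = λ u v → path⇒walk (proj₂ (strong u v))
    ; noBypass = noBypass
    }
    where
      noBypass : ∀ {u v} → Arc D u v → ¬ Star (ArcExcept D u v) u v
      noBypass {u} uv bypass with erase _≟ᶠ_ bypass
      ... | ε , _ = contradiction (trans (sym uv) (loopless D u)) λ ()
      ... | ((_ , uv≢uv) ◅ ε) , _ = uv≢uv (refl , refl)
      ... | s@(_ ◅ _ ◅ _) , simple , _ =
        noTransitive _ _ (uv , _ , s≤s (s≤s z≤n) , simple⇒path proj₁ s simple)

  walkMinimalStrong-converse : WalkMinimalStrong D → WalkMinimalStrong (converse D)
  walkMinimalStrong-converse minimal = record
    { reach    = λ u v → Star.reverse id (reach v u)
    ; noBypass = λ vu bypass → noBypass vu (Star.reverse (λ (r , ≢) → r , ≢ ∘ swap) bypass)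
    }
    where open WalkMinimalStrong minimal

  stronglyConnectedIn-converse : ∀ {X} → StronglyConnectedIn D X → StronglyConnectedIn (converse D) X
  stronglyConnectedIn-converse strong Xa Xb = Star.reverse (λ (r , Xu , Xv) → r , Xv , Xu) (strong Xb Xa)

  linear-intro : ∀ {v a b} → Arc D a v → (∀ {u} → Arc D u v → u ≡ a) →
                 Arc D v b → (∀ {u} → Arc D v u → u ≡ b) → Linear D v
  linear-intro av only-a vb only-b =
    count≡1 _ (Equivalence.from T-≡ av) (only-a ∘ Equivalence.to T-≡) ,
    count≡1 _ (Equivalence.from T-≡ vb) (only-b ∘ Equivalence.to T-≡)

  linear-converse : ∀ {v} → Linear D v → Linear (converse D) v
  linear-converse = swap

  numLinear-converse : numLinear (converse D) ≡ numLinear D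
  numLinear-converse = count-≐ (linear? (converse D)) (linear? D) (swap , swap)

record ReturnWalk {n : ℕ} (D : Digraph n) (X : Fin n → Set) (w : Fin n) : Set where
  field
    {s x}   : Fin n
    first   : Arc D w s
    tail    : Star (Arc D) s x
    end     : X x
    outside : ∀ {v} → v ∈ support tail → ¬ X v
    fresh   : w ∉ support tail

returnWalk : ∀ {n} {D : Digraph n} {X} → Decidable X →
             ∀ {w t} → Star (Arc D) w t → X t → ¬ X w → ReturnWalk D X w
returnWalk X? back Xt ¬Xw with firstHit X? back Xt
... | x , Xx , walk , outside with erase _≟ᶠ_ walk
...   | ε , _ = ⊥-elim (¬Xw Xx)
...   | first ◅ tail , (unique , _) , ⊆walk = record
  { first   = first
  ; tail    = tail
  ; end     = Xx
  ; outside = All.lookup outside ∘ ⊆walk ∘ there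
  ; fresh   = Unique[x∷xs]⇒x∉xs unique
  }

module ReturnWalkProperties {n : ℕ} {D : Digraph n} (minimal : WalkMinimalStrong D)
  {X : Fin n → Set} (X? : Decidable X) (strong : StronglyConnectedIn D X)
  {t w : Fin n} (Xt : X t) (tw : Arc D t w) (¬Xw : ¬ X w) (R : ReturnWalk D X w) where

  open WalkLemmas D
  open WalkMinimalStrong minimal
  open ReturnWalk R
  open DecMembership (_≟ᶠ_ {n}) using (_∈?_)

  ear : Star (Arc D) w x
  ear = first ◅ tail

  Ear : Fin n → Set
  Ear = _∈ support ear

  X⁺ : Fin n → Set
  X⁺ = Ear ∪ X

  X⁺? : Decidable X⁺
  X⁺? = (_∈? support ear) ∪? X?

  ear-outside : ∀ {v} → Ear v → ¬ X v
  ear-outside (here refl) = ¬Xw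
  ear-outside (there v∈) = outside v∈

  count-shrinks : count (∁? X⁺?) < count (∁? X?)
  count-shrinks =
    count-< (∁? X⁺?) (∁? X?) (λ ¬X⁺v Xv → ¬X⁺v (inj₂ Xv)) ¬Xw (λ ¬X⁺w → ¬X⁺w (inj₁ (here refl)))

  w-to-ear : ∀ {P : Fin n → Set} → (∀ {v} → Ear v → P v) → ∀ {y} → Ear y → Star (ArcIn D P) w y
  w-to-ear P-ear y∈ = let p , p⊆ear = takeTo ear y∈ in within p (P-ear ∘ p⊆ear) (P-ear y∈)

  ear-to-t : ∀ {y} → Ear y → Star (ArcIn D X⁺) y t
  ear-to-t y∈ = let p , p⊆ear = dropTo ear y∈ in
    within p (inj₁ ∘ p⊆ear) (inj₂ end) ◅◅ widen inj₂ (strong end Xt)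

  X⁺-strong : StronglyConnectedIn D X⁺
  X⁺-strong X⁺a X⁺b = to-t X⁺a ◅◅ from-t X⁺b
    where
      to-t : ∀ {a} → X⁺ a → Star (ArcIn D X⁺) a t
      to-t (inj₁ a∈) = ear-to-t a∈
      to-t (inj₂ Xa) = widen inj₂ (strong Xa Xt)
      from-t : ∀ {b} → X⁺ b → Star (ArcIn D X⁺) t b
      from-t (inj₁ b∈) = (tw , inj₂ Xt , inj₁ (here refl)) ◅ w-to-ear inj₁ b∈
      from-t (inj₂ Xb) = widen inj₂ (strong Xt Xb)

  exit-preserved : ∀ {z} → X z → z ≢ t → Exit D X z → Exit D X⁺ z
  exit-preserved Xz z≢t (y , zy , ¬Xy) = y , zy , λ
    { (inj₂ Xy) → ¬Xy Xy
    ; (inj₁ y∈) → noBypass zy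
        (avoidTarget ¬Xy (strong Xz Xt) ◅◅
         (tw , λ (t≡z , _) → z≢t (sym t≡z)) ◅
         avoidSource (λ ¬Xz → ¬Xz Xz) (w-to-ear ear-outside y∈))
    }

  -- X⁺ without w: a walk inside Y avoids every arc into or out of w.
  Y : Fin n → Set
  Y = X ∪ (_∈ support tail)

  ¬Yw : ¬ Y w
  ¬Yw (inj₁ Xw) = ¬Xw Xw
  ¬Yw (inj₂ w∈) = fresh w∈

  s-to-Y : ∀ {y} → Y y → Star (ArcIn D Y) s y
  s-to-Y (inj₁ Xy) = within tail inj₂ (inj₁ end) ◅◅ widen inj₁ (strong end Xy)
  s-to-Y (inj₂ y∈) = let p , p⊆tail = takeTo tail y∈ in within p (inj₂ ∘ p⊆tail) (inj₂ y∈)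

  Y-to-t : ∀ {y} → Y y → Star (ArcIn D Y) y t
  Y-to-t (inj₁ Xy) = widen inj₁ (strong Xy Xt)
  Y-to-t (inj₂ y∈) = let p , p⊆tail = dropTo tail y∈ in
    within p (inj₂ ∘ p⊆tail) (inj₁ end) ◅◅ widen inj₁ (strong end Xt)

  module Closed (closed : ∀ {y} → Ear y → ¬ Exit D X⁺ y) where

    no-loop-at-w : ¬ Arc D w w
    no-loop-at-w ww = noBypass ww ε

    -- A walk t ⇝ z last leaves X⁺ by an arc y → b with y ∈ X (the ear is closed),
    -- so t ⇝ y → b ⇝ z → w bypasses t → w.
    in-neighbour-outside : ∀ {z} → Arc D z w → ¬ X⁺ z → ⊥
    in-neighbour-outside {z} zw ¬X⁺z with lastExit X⁺? (reach t z) ¬X⁺z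
    ... | inj₁ (¬X⁺t , _) = ¬X⁺t (inj₂ Xt)
    ... | inj₂ (_ , b , inj₁ y∈ , yb , ¬X⁺b , _) = closed y∈ (b , yb , ¬X⁺b)
    ... | inj₂ (_ , b , inj₂ Xy , yb , ¬X⁺b , b⇝z) = noBypass tw
      (avoidTarget ¬Xw (strong Xt Xy) ◅◅
       (yb , λ (_ , b≡w) → ¬X⁺b (inj₁ (here b≡w))) ◅
       avoidTarget (λ ¬X⁺w → ¬X⁺w (inj₁ (here refl))) b⇝z ◅◅
       (zw , λ (z≡t , _) → ¬X⁺z (inj₂ (subst X (sym z≡t) Xt))) ◅ ε)

    bypass-into-w : ∀ {z} → Arc D z w → z ≢ t → Y z → ⊥
    bypass-into-w zw z≢t Yz =
      noBypass zw (avoidTarget ¬Yw (Y-to-t Yz) ◅◅ (tw , λ (t≡z , _) → z≢t (sym t≡z)) ◅ ε)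

    bypass-out-of-w : ∀ {u} → Arc D w u → u ≢ s → Y u → ⊥
    bypass-out-of-w wu u≢s Yu =
      noBypass wu ((first , λ (_ , s≡u) → u≢s (sym s≡u)) ◅ avoidSource ¬Yw (s-to-Y Yu))

    only-t : ∀ {z} → Arc D z w → z ≡ t
    only-t {z} zw with z ≟ᶠ t | X⁺? z
    ... | yes z≡t | _                      = z≡t
    ... | no _    | no ¬X⁺z                = ⊥-elim (in-neighbour-outside zw ¬X⁺z)
    ... | no _    | yes (inj₁ (here refl)) = ⊥-elim (no-loop-at-w zw)
    ... | no z≢t  | yes (inj₁ (there z∈)) = ⊥-elim (bypass-into-w zw z≢t (inj₂ z∈))
    ... | no z≢t  | yes (inj₂ Xz)         = ⊥-elim (bypass-into-w zw z≢t (inj₁ Xz))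

    only-s : ∀ {u} → Arc D w u → u ≡ s
    only-s {u} wu with u ≟ᶠ s | X⁺? u
    ... | yes u≡s | _                      = u≡s
    ... | no _    | no ¬X⁺u                = ⊥-elim (closed (here refl) (u , wu , ¬X⁺u))
    ... | no _    | yes (inj₁ (here refl)) = ⊥-elim (no-loop-at-w wu)
    ... | no u≢s  | yes (inj₁ (there u∈)) = ⊥-elim (bypass-out-of-w wu u≢s (inj₂ u∈))
    ... | no u≢s  | yes (inj₂ Xu)         = ⊥-elim (bypass-out-of-w wu u≢s (inj₁ Xu))

    w-linear : Linear D w
    w-linear = linear-intro tw only-t first only-s

module _ {n : ℕ} {D : Digraph n} (minimal : WalkMinimalStrong D) where
  open WalkMinimalStrong minimal

  exits⇒linear : ∀ {X} (X? : Decidable X) → Acc _<_ (count (∁? X?)) → StronglyConnectedIn D X →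
                 ∀ {ts ks} → Unique ts → All (λ t → X t × Exit D X t) ts →
                 Unique ks → All (λ v → Linear D v × X v) ks →
                 length ts + length ks ≤ numLinear D
  exits⇒linear X? _ _ [] [] unique-ks linear-ks =
    unique⇒length≤count (linear? D) unique-ks (All.map proj₁ linear-ks)
  exits⇒linear {X} X? (acc smaller) strong {t ∷ ts} {ks}
               (t∉ts ∷ unique-ts) ((Xt , w , tw , ¬Xw) ∷ exits) unique-ks linear-ks =
    extend (Any.any? (exit? D X⁺?) (support ear))
    where
      open ReturnWalkProperties minimal X? strong Xt tw ¬Xw (returnWalk X? (reach w t) Xt ¬Xw)

      exits⁺ : All (λ t′ → X⁺ t′ × Exit D X⁺ t′) ts
      exits⁺ = All.zipWith (λ (t≢t′ , Xt′ , exit) → inj₂ Xt′ , exit-preserved Xt′ (t≢t′ ∘ sym) exit)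
                           (t∉ts , exits)

      linear-ks⁺ : All (λ v → Linear D v × X⁺ v) ks
      linear-ks⁺ = All.map (λ (linear , Xv) → linear , inj₂ Xv) linear-ks

      extend : Dec (Any (Exit D X⁺) (support ear)) → length (t ∷ ts) + length ks ≤ numLinear D
      extend (yes ear-exit) =
        let y , y∈ , y-exit = find ear-exit in
        exits⇒linear X⁺? (smaller count-shrinks) X⁺-strong
          (All.map (λ (Xt′ , _) y≡t′ → ear-outside y∈ (subst X (sym y≡t′) Xt′)) exits ∷ unique-ts)
          ((inj₁ y∈ , y-exit) ∷ exits⁺) unique-ks linear-ks⁺
      extend (no no-ear-exit) = subst (_≤ numLinear D) (+-suc (length ts) (length ks))
        (exits⇒linear X⁺? (smaller count-shrinks) X⁺-strong unique-ts exits⁺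
          (All.map (λ (_ , Xv) w≡v → ¬Xw (subst X (sym w≡v) Xv)) linear-ks ∷ unique-ks)
          ((Closed.w-linear (λ y∈ y-exit → no-ear-exit (lose y∈ y-exit)) , inj₁ (here refl)) ∷ linear-ks⁺))

module _ {q : ℕ} where

  sucMod-fromℕ : sucMod (fromℕ q) ≡ zero
  sucMod-fromℕ with toℕ (fromℕ q) ≟ⁿ q
  ... | yes _ = refl
  ... | no ≢q = contradiction (toℕ-fromℕ q) ≢q

  sucMod-inject₁ : (i : Fin q) → sucMod (inject₁ i) ≡ suc i
  sucMod-inject₁ i with toℕ (inject₁ i) ≟ⁿ q
  ... | yes ≡q = contradiction (sym ≡q) (toℕ-inject₁-≢ i)
  ... | no _ = cong suc (lower₁-inject₁′ i _)

  sucMod-injective : Injective _≡_ _≡_ (sucMod {suc q})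
  sucMod-injective {i} {j} eq with view i | view j
  ... | ‵fromℕ      | ‵fromℕ      = refl
  ... | ‵fromℕ      | ‵inject₁ j′ =
    contradiction (trans (sym sucMod-fromℕ) (trans eq (sucMod-inject₁ j′))) λ ()
  ... | ‵inject₁ i′ | ‵fromℕ      =
    contradiction (trans (sym (sucMod-inject₁ i′)) (trans eq sucMod-fromℕ)) λ ()
  ... | ‵inject₁ i′ | ‵inject₁ j′ =
    cong inject₁ (suc-injective (trans (sym (sucMod-inject₁ i′)) (trans eq (sucMod-inject₁ j′))))

  sucMod-predecessor : (i : Fin (suc q)) → ∃ λ p → sucMod p ≡ i
  sucMod-predecessor zero = fromℕ q , sucMod-fromℕ
  sucMod-predecessor (suc i) = inject₁ i , sucMod-inject₁ i

  sucMod-connected : (i j : Fin (suc q)) → Star (λ a b → sucMod a ≡ b) i j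
  sucMod-connected i j = to-last i ◅◅ sucMod-fromℕ ◅ from-zero j
    where
      to-last : ∀ i → Star (λ a b → sucMod a ≡ b) i (fromℕ q)
      to-last = >-weakInduction _ ε λ i rest → sucMod-inject₁ i ◅ rest
      from-zero : ∀ j → Star (λ a b → sucMod a ≡ b) zero j
      from-zero = <-weakInduction _ ε λ i path → path ◅◅ sucMod-inject₁ i ◅ ε

module CycleBound {n q : ℕ} {D : Digraph n} (minimal : WalkMinimalStrong D) (C : Cycle D (suc q)) where
  open WalkMinimalStrong minimal
  open WalkLemmas D
  open Cycle C renaming (vert to c; distinct to c-injective)

  OnCycle : Fin n → Set
  OnCycle v = ∃ λ i → c i ≡ v

  onCycle? : Decidable OnCycle
  onCycle? v = any? λ i → c i ≟ᶠ v

  onCycle-strong : StronglyConnectedIn D OnCycle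
  onCycle-strong (i , refl) (j , refl) =
    Star.gmap c (λ { {a} refl → step a , (a , refl) , (sucMod a , refl) }) (sucMod-connected i j)

  chord-free : ∀ {i j} → Arc D (c i) (c j) → j ≡ sucMod i
  chord-free {i} {j} ij with j ≟ᶠ sucMod i
  ... | yes j≡ = j≡
  ... | no j≢ = ⊥-elim (noBypass ij
        ((step i , λ (_ , e) → j≢ (c-injective (sym e))) ◅
         Star.gmap c cycle-arc (sucMod-connected (sucMod i) j)))
    where
      cycle-arc : ∀ {a b} → sucMod a ≡ b → ArcExcept D (c i) (c j) (c a) (c b)
      cycle-arc {a} refl = step a , λ (a≡i , b≡j) →
        j≢ (trans (sym (c-injective b≡j)) (cong sucMod (c-injective a≡i)))

  exits? : Decidable (Exit D OnCycle ∘ c)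
  exits? = exit? D onCycle? ∘ c

  entries? : Decidable (Exit (converse D) OnCycle ∘ c)
  entries? = exit? (converse D) onCycle? ∘ c

  Quiet : Fin (suc q) → Set
  Quiet = ∁ (Exit D OnCycle ∘ c) ∩ ∁ (Exit (converse D) OnCycle ∘ c)

  quiet? : Decidable Quiet
  quiet? = ∁? exits? ∩? ∁? entries?

  quiet-linear : ∀ {i} → Quiet i → Linear D (c i)
  quiet-linear {i} (no-exit , no-entry) with sucMod-predecessor i
  ... | p , refl = linear-intro (step p) only-p (step (sucMod p)) only-next
    where
      only-p : ∀ {z} → Arc D z (c (sucMod p)) → z ≡ c p
      only-p {z} zi with onCycle? z
      ... | yes (k , refl) = cong c (sucMod-injective (sym (chord-free zi)))
      ... | no off = ⊥-elim (no-entry (z , zi , off))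
      only-next : ∀ {u} → Arc D (c (sucMod p)) u → u ≡ c (sucMod (sucMod p))
      only-next {u} iu with onCycle? u
      ... | yes (k , refl) = cong c (chord-free iu)
      ... | no off = ⊥-elim (no-exit (u , iu , off))

  on-cycle : ∀ {P : Fin (suc q) → Set} → Decidable P → List (Fin n)
  on-cycle P? = map c (filter P? (allFin (suc q)))

  on-cycle-unique : ∀ {P : Fin (suc q) → Set} (P? : Decidable P) → Unique (on-cycle P?)
  on-cycle-unique P? = Unique-map⁺ c-injective (Unique-filter⁺ P? (allFin⁺ (suc q)))

  on-cycle-all : ∀ {P : Fin (suc q) → Set} {Q : Fin n → Set} (P? : Decidable P) →
                 (∀ {i} → P i → Q (c i)) → All Q (on-cycle P?)
  on-cycle-all P? P⇒Q = All-map⁺ (All.map P⇒Q (all-filter P? (allFin (suc q))))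

  length-on-cycle : ∀ {P : Fin (suc q) → Set} (P? : Decidable P) → length (on-cycle P?) ≡ count P?
  length-on-cycle P? = length-map c (filter P? (allFin (suc q)))

  linear-bound : (G : Digraph n) → WalkMinimalStrong G → StronglyConnectedIn G OnCycle →
                 (∀ {i} → Quiet i → Linear G (c i)) →
                 count (exit? G onCycle? ∘ c) + count quiet? ≤ numLinear G
  linear-bound G minimalG strongG quiet⇒linear =
    subst₂ (λ a b → a + b ≤ numLinear G) (length-on-cycle (exit? G onCycle? ∘ c)) (length-on-cycle quiet?)
      (exits⇒linear minimalG onCycle? (<-wellFounded _) strongG
        (on-cycle-unique (exit? G onCycle? ∘ c)) (on-cycle-all (exit? G onCycle? ∘ c) ((_ , refl) ,_))
        (on-cycle-unique quiet?) (on-cycle-all quiet? λ quiet → quiet⇒linear quiet , (_ , refl)))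

  twice-numLinear : suc q ≤ numLinear D + numLinear D
  twice-numLinear = begin
    suc q                                           ≡⟨ length-tabulate id ⟨
    length (allFin (suc q))                         ≤⟨ length≤filter+filter+neither exits? entries? _ ⟩
    count exits? + (count entries? + count quiet?)  ≤⟨ +-monoˡ-≤ _ (m≤m+n (count exits?) (count quiet?)) ⟩
    count exits? + count quiet? + (count entries? + count quiet?)
      ≤⟨ +-mono-≤ (linear-bound D minimal onCycle-strong quiet-linear) entries-bound ⟩
    numLinear D + numLinear D                       ∎
    where
      open ≤-Reasoning
      entries-bound : count entries? + count quiet? ≤ numLinear D
      entries-bound = subst (count entries? + count quiet? ≤_) numLinear-converse
        (linear-bound (converse D) (walkMinimalStrong-converse minimal)
          (stronglyConnectedIn-converse onCycle-strong) (linear-converse ∘ quiet-linear))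

half-≤ : ∀ {m N} → m ≤ N + N → (m + 1) / 2 ≤ N
half-≤ {m} {N} m≤N+N = s≤s⁻¹ (m<n*o⇒m/o<n (begin-strict
  m + 1              ≡⟨ +-comm m 1 ⟩
  suc m              ≤⟨ s≤s m≤N+N ⟩
  suc (N + N)        <⟨ n<1+n _ ⟩
  suc (suc (N + N))  ≡⟨ cong (2 +_) (trans (*-suc N 1) (cong (N +_) (*-identityʳ N))) ⟨
  suc N * 2          ∎))
  where open ≤-Reasoning

theorem4 : ∀ {n : ℕ} (D : Digraph n) → MinimalStrong D →
    ∀ (q : ℕ) → q ≥ 2 → Cycle D q →
    numLinear D ≥ (q + 1) / 2
theorem4 D ms zero () C
theorem4 D ms (suc q) _ C =
  half-≤ (CycleBound.twice-numLinear (WalkLemmas.minimalStrong⇒walkMinimalStrong D ms) C)
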